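{- Under quiescent consistency, $\mathcal Q$ is a correct implementation of $\mathcal S$ iff $L(\mathcal Q_\delta) \subseteq \mathcal L_U(\mathcal S_\delta)$.
   Context: $\mathcal S$ (specification, sequential) and $\mathcal Q$ (implementation) are finite automata over invocation/response events, each associated with a process; an invocation matches a response iff same process and operation. Legal: the restriction to each process alternates invocation and matching response starting with an invocation. Quiescent: no invocation without a later matching response; end-to-end quiescent: quiescent with no quiescent non-empty proper prefix. All runs are legal and a path from the initial state is quiescent iff it ends in a final state. $\mathcal S_\delta$ adds a self-loop labelled $\delta\notin\Sigma$ at each quiescent state of $\mathcal S$; $\mathcal Q_\delta$ forces a $\delta$ transition out of every quiescent state of $\mathcal Q$ (to a new copy state carrying the original outgoing transitions and finality). $U=\Sigma\times\Sigma$ and $\mathcal L_U(\mathcal M)$ is the closure of $L(\mathcal M)$ under swapping adjacent non-$\delta$ events. $\mathcal Q$ is correct under quiescent consistency iff every run of $\mathcal Q$ is allowed, i.e. each run $\sigma_1\cdots\sigma_k$ (end-to-end quiescent blocks) has block-wise permutations forming a run of $\mathcal S$. -}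

module Defs where

open import Data.Nat using (ℕ; _+_)
open import Data.Fin using (Fin; splitAt; _≟_)
open import Data.Bool using (Bool; true; false; _∧_; not)
open import Data.Sum using (_⊎_; inj₁; inj₂)
open import Data.Product using (Σ; ∃; _×_; _,_)
open import Data.Unit using (⊤)
open import Data.Empty using (⊥)
open import Data.List using (List; []; _∷_; _++_; filter; concat)
open import Data.List.Membership.Propositional using (_∈_)
open import Data.List.Relation.Unary.All using (All)
open import Data.List.Relation.Binary.Pointwise using (Pointwise)
open import Data.List.Relation.Binary.Permutation.Propositional using (_↭_)
open import Relation.Nullary using (¬_)
open import Relation.Nullary.Decidable using (⌊_⌋)
open import Relation.Binary.PropositionalEquality using (_≡_; _≢_)

data Event (P O : ℕ) : Set where
  inv : Fin P → Fin O → Event P O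
  res : Fin P → Fin O → Event P O

module _ {P O : ℕ} where

  proc : Event P O → Fin P
  proc (inv p _) = p
  proc (res p _) = p

  restrict : Fin P → List (Event P O) → List (Event P O)
  restrict p = filter (λ e → proc e ≟ p)

  Alt : List (Event P O) → Set
  Alt [] = ⊤
  Alt (inv p o ∷ []) = ⊤
  Alt (inv p o ∷ inv _ _ ∷ _) = ⊥
  Alt (inv p o ∷ res p' o' ∷ w) = (p ≡ p') × (o ≡ o') × Alt w
  Alt (res _ _ ∷ _) = ⊥

  Legal : List (Event P O) → Set
  Legal w = ∀ p → Alt (restrict p w)

  Quiescent : List (Event P O) → Set
  Quiescent w = ∀ u p o v → w ≡ u ++ inv p o ∷ v → res p o ∈ v

  EndToEnd : List (Event P O) → Set
  EndToEnd w = (w ≢ []) × Quiescent w ×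
    (∀ u v → w ≡ u ++ v → u ≢ [] → v ≢ [] → ¬ Quiescent u)

record FA (A : Set) : Set where
  field
    n     : ℕ
    init  : Fin n
    trans : Fin n → A → Fin n → Bool
    final : Fin n → Bool

open FA public

data Path {A : Set} (M : FA A) : Fin (n M) → List A → Fin (n M) → Set where
  here : ∀ {q} → Path M q [] q
  step : ∀ {q a q' w q''} → trans M q a q' ≡ true → Path M q' w q'' →
         Path M q (a ∷ w) q''

Run : {A : Set} → FA A → List A → Set
Run M w = ∃ λ q → Path M (init M) w q

L : {A : Set} → FA A → List A → Set
L M w = ∃ λ q → Path M (init M) w q × final M q ≡ true

WellFormed : {P O : ℕ} → FA (Event P O) → Set
WellFormed M = ∀ w q → Path M (init M) w q →
  Legal w × (final M q ≡ true → Quiescent w) × (Quiescent w → final M q ≡ true)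

data Ext (A : Set) : Set where
  ev : A → Ext A
  δ  : Ext A

Sδ : {A : Set} → FA A → FA (Ext A)
Sδ M = record
  { n = n M
  ; init = init M
  ; trans = tr
  ; final = final M
  }
  where
  tr : Fin (n M) → Ext _ → Fin (n M) → Bool
  tr q (ev a) q' = trans M q a q'
  tr q δ q' = final M q ∧ ⌊ q ≟ q' ⌋

-- Q_δ : states  inj₁ q (original) and  inj₂ q (copy of q).
Qδ : {A : Set} → FA A → FA (Ext A)
Qδ M = record
  { n = n M + n M
  ; init = Data.Fin.join (n M) (n M) (inj₁ (init M))
  ; trans = λ i a j → tr (splitAt (n M) i) a (splitAt (n M) j)
  ; final = λ i → fin (splitAt (n M) i)
  }
  where
  tr : Fin (n M) ⊎ Fin (n M) → Ext _ → Fin (n M) ⊎ Fin (n M) → Bool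
  tr (inj₁ q) δ      (inj₂ q') = final M q ∧ ⌊ q ≟ q' ⌋
  tr (inj₁ q) (ev a) (inj₁ q') = not (final M q) ∧ trans M q a q'
  tr (inj₂ q) (ev a) (inj₁ q') = trans M q a q'
  tr _        _      _         = false
  fin : Fin (n M) ⊎ Fin (n M) → Bool
  fin (inj₁ q) = false
  fin (inj₂ q) = final M q

-- L_U : closure under swapping adjacent non-δ events (U = Σ × Σ)
data SwapClosure {A : Set} (Lang : List (Ext A) → Set) : List (Ext A) → Set where
  base : ∀ {w} → Lang w → SwapClosure Lang w
  swap : ∀ u a b v → SwapClosure Lang (u ++ ev a ∷ ev b ∷ v) →
         SwapClosure Lang (u ++ ev b ∷ ev a ∷ v)

LU : {A : Set} → FA (Ext A) → List (Ext A) → Set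
LU M = SwapClosure (L M)

Allowed : {P O : ℕ} → FA (Event P O) → List (Event P O) → Set
Allowed S w = Σ (List (List _)) λ bs → All EndToEnd bs × concat bs ≡ w ×
  Σ (List (List _)) λ bs' → Pointwise _↭_ bs bs' × L S (concat bs')

CorrectQC : {P O : ℕ} → FA (Event P O) → FA (Event P O) → Set
CorrectQC S Q = ∀ w → L Q w → Allowed S w

-- In a well-formed automaton a path from the initial state is quiescent iff
-- it ends in a final state, so the end-to-end quiescent blocks of a run of Q
-- are exactly its stretches between consecutive visits to final states, and
-- Qδ marks each visit by a δ.  Hence L(Qδ) consists of the words
-- form bs = δ b₁ δ ⋯ bₖ δ  for the (unique) end-to-end decompositions bs of
-- the runs of Q.  Swaps of adjacent non-δ events never cross a δ, so the
-- swap-closure of L(Sδ) contains  form bs  iff some block-wise permutation cs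
-- of bs has  form cs ∈ L(Sδ), i.e. concat cs is a run of S whose block cuts
-- are quiescent.  For block-wise permutations of quiescent blocks the cuts are
-- automatically quiescent: among legal words quiescence is invariant under
-- permutation, since it amounts to every per-process restriction having even
-- length.
module Submission where

open import Defs
open import Data.Nat using (ℕ; zero; suc)
open import Data.Bool using (Bool; true; false)
open import Data.List using (List; []; _∷_; _++_; length; concat; map)
open import Data.List.NonEmpty using (List⁺; _∷_; toList)
import Data.List.NonEmpty as List⁺
open import Data.List.Properties using (++-assoc; ++-identityʳ; filter-++; filter-accept; ∷-injective)
open import Data.List.Membership.Propositional using (_∈_)
open import Data.List.Membership.Propositional.Properties using (∈-++⁺ˡ; ∈-filter⁺; ∈-filter⁻)
open import Data.List.Relation.Unary.Any using (here)
open import Data.List.Relation.Unary.All using (All; []; _∷_)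
import Data.List.Relation.Unary.All as All
open import Data.List.Relation.Binary.Permutation.Propositional using (_↭_; ↭-refl; ↭-sym; ↭-trans)
import Data.List.Relation.Binary.Permutation.Propositional as Perm
open import Data.List.Relation.Binary.Permutation.Propositional.Properties using (filter-↭; ↭-length; ↭-empty-inv) renaming (++⁺ to ↭-++)
open import Data.List.Relation.Binary.Pointwise using (Pointwise; []; _∷_)
import Data.List.Relation.Binary.Pointwise as Pw
open import Relation.Binary.Construct.Closure.ReflexiveTransitive using (Star; ε; _◅_; _◅◅_; gmap)
open import Data.Product using (∃; ∃₂; _×_; _,_; proj₁; proj₂)
open import Data.Sum using (_⊎_; inj₁; inj₂)
open import Data.Empty using (⊥; ⊥-elim)
open import Relation.Nullary using (¬_; yes; no)
open import Data.Fin using (Fin; _≟_; splitAt; join)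
open import Data.Fin.Properties using (splitAt-join)
open import Function.Bundles using (_⇔_; mk⇔)
open import Relation.Nullary.Decidable using (⌊_⌋; isYes≗does; dec-true)
open import Relation.Binary.PropositionalEquality
  using (_≡_; _≢_; refl; sym; cong; cong₂; subst; module ≡-Reasoning) renaming (trans to ≡-trans)

module _ {A : Set} where

  ++-dichotomy : ∀ (b r c s : List A) → b ++ r ≡ c ++ s →
    (∃ λ v → c ≡ b ++ v × r ≡ v ++ s) ⊎ (∃ λ v → b ≡ c ++ v × s ≡ v ++ r)
  ++-dichotomy []      r c       s eq = inj₁ (c , refl , eq)
  ++-dichotomy (x ∷ b) r []      s eq = inj₂ (x ∷ b , refl , sym eq)
  ++-dichotomy (x ∷ b) r (y ∷ c) s eq with ∷-injective eq
  ... | refl , eq′ with ++-dichotomy b r c s eq′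
  ...   | inj₁ (v , c≡ , r≡) = inj₁ (v , cong (x ∷_) c≡ , r≡)
  ...   | inj₂ (v , b≡ , s≡) = inj₂ (v , cong (x ∷_) b≡ , s≡)

module _ {P O : ℕ} where

  quiescent-[] : Quiescent {P} {O} []
  quiescent-[] []      p o v ()
  quiescent-[] (_ ∷ _) p o v ()

  -- Every pending invocation of y is pending in x ++ y, so it gets answered in y.
  quiescent-suffix : ∀ (x y : List (Event P O)) → Quiescent (x ++ y) → Quiescent y
  quiescent-suffix x y q u p o v y≡ =
    q (x ++ u) p o v (≡-trans (cong (x ++_) y≡) (sym (++-assoc x u _)))

  quiescent-++ : ∀ {x y : List (Event P O)} → Quiescent x → Quiescent y → Quiescent (x ++ y)
  quiescent-++ {x} {y} qx qy u p o v eq with ++-dichotomy x y u (inv p o ∷ v) eq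
  ... | inj₁ (w , _ , y≡)        = qy w p o v y≡
  ... | inj₂ ([] , _ , inv∷v≡y)  = qy [] p o v (sym inv∷v≡y)
  ... | inj₂ (w ∷ ws , x≡ , eq′) with ∷-injective eq′
  ...   | refl , v≡ = subst (res p o ∈_) (sym v≡) (∈-++⁺ˡ (qx u p o ws x≡))

  -- A word has at most one decomposition into end-to-end quiescent blocks:
  -- of two competing first blocks, the shorter would be a quiescent proper
  -- prefix of the longer.
  endToEnd-unique : ∀ (bs cs : List (List (Event P O))) → All EndToEnd bs → All EndToEnd cs →
    concat bs ≡ concat cs → bs ≡ cs
  endToEnd-unique []       []            _        _        _ = refl
  endToEnd-unique []       ([] ∷ _)      _        ((c≢[] , _) ∷ _) _ = ⊥-elim (c≢[] refl)
  endToEnd-unique []       ((_ ∷ _) ∷ _) _        _        ()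
  endToEnd-unique ([] ∷ _) []            ((b≢[] , _) ∷ _) _ _ = ⊥-elim (b≢[] refl)
  endToEnd-unique ((_ ∷ _) ∷ _) []       _        _        ()
  endToEnd-unique (b ∷ bs) (c ∷ cs) (eb ∷ ebs) (ec ∷ ecs) eq
    with ++-dichotomy b (concat bs) c (concat cs) eq
  ... | inj₁ ([] , c≡b++[] , rest) =
    cong₂ _∷_ (sym (≡-trans c≡b++[] (++-identityʳ b)))
              (endToEnd-unique bs cs ebs ecs rest)
  ... | inj₁ (v ∷ vs , c≡ , _) =
    ⊥-elim (proj₂ (proj₂ ec) b (v ∷ vs) c≡ (proj₁ eb) (λ ()) (proj₁ (proj₂ eb)))
  ... | inj₂ ([] , b≡c++[] , rest) =
    cong₂ _∷_ (≡-trans b≡c++[] (++-identityʳ c))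
              (endToEnd-unique bs cs ebs ecs (sym rest))
  ... | inj₂ (v ∷ vs , b≡ , _) =
    ⊥-elim (proj₂ (proj₂ eb) c (v ∷ vs) b≡ (proj₁ ec) (λ ()) (proj₁ (proj₂ ec)))

  -- For a legal word, quiescence means that every restriction to a
  -- single process has even length; lengths of restrictions are invariant
  -- under permutation, hence so is quiescence (among legal words).

  even : ℕ → Bool
  even zero          = true
  even (suc zero)    = false
  even (suc (suc n)) = even n

  even-snoc : ∀ {X : Set} (l : List X) x → even (length l) ≡ true → even (length (l ++ x ∷ [])) ≡ false
  even-snoc []          x _      = refl
  even-snoc (_ ∷ _ ∷ l) x even-l = even-snoc l x even-l

  alt-split : ∀ (l₁ l₂ : List (Event P O)) {p o} → Alt (l₁ ++ inv p o ∷ l₂) →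
    even (length l₁) ≡ true × Alt (inv p o ∷ l₂)
  alt-split []                       l₂ alt           = refl , alt
  alt-split (inv _ _ ∷ [])           l₂ ()
  alt-split (inv _ _ ∷ inv _ _ ∷ l₁) l₂ ()
  alt-split (inv _ _ ∷ res _ _ ∷ l₁) l₂ (_ , _ , alt) = alt-split l₁ l₂ alt
  alt-split (res _ _ ∷ l₁)           l₂ ()

  alt-answered : ∀ (l₁ l₂ : List (Event P O)) {p o} → Alt (l₁ ++ inv p o ∷ l₂) →
    even (length (l₁ ++ inv p o ∷ l₂)) ≡ true → res p o ∈ l₂
  alt-answered l₁ [] {p} {o} alt even-len
    with () ← ≡-trans (sym even-len) (even-snoc l₁ (inv p o) (proj₁ (alt-split l₁ [] alt)))
  alt-answered l₁ (inv _ _ ∷ l₂) alt even-len with alt-split l₁ _ alt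
  ... | _ , ()
  alt-answered l₁ (res _ _ ∷ l₂) alt even-len with alt-split l₁ _ alt
  ... | _ , refl , refl , _ = here refl

  alt-quiescent-even : ∀ (l : List (Event P O)) → Alt l → Quiescent l → even (length l) ≡ true
  alt-quiescent-even []                      _             _ = refl
  alt-quiescent-even (inv p o ∷ [])          _             q with () ← q [] p o [] refl
  alt-quiescent-even (inv _ _ ∷ inv _ _ ∷ l) ()
  alt-quiescent-even (inv p o ∷ res _ _ ∷ l) (_ , _ , alt) q =
    alt-quiescent-even l alt (quiescent-suffix (inv p o ∷ res _ _ ∷ []) l q)
  alt-quiescent-even (res _ _ ∷ _)           ()

  restrict-locate : ∀ p (y : List (Event P O)) u e v → restrict p y ≡ u ++ e ∷ v →
    ∃₂ λ y₁ y₂ → y ≡ y₁ ++ e ∷ y₂ × restrict p y₂ ≡ v × proc e ≡ p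
  restrict-locate p []      []      e v ()
  restrict-locate p []      (_ ∷ _) e v ()
  restrict-locate p (z ∷ y) u e v eq with proc z ≟ p
  restrict-locate p (z ∷ y) [] e v eq | yes proc-z≡p with ∷-injective eq
  ... | refl , v≡ = [] , y , refl , v≡ , proc-z≡p
  restrict-locate p (z ∷ y) (_ ∷ u) e v eq | yes _
    with restrict-locate p y u e v (proj₂ (∷-injective eq))
  ... | y₁ , y₂ , y≡ , v≡ , proc-e≡p = z ∷ y₁ , y₂ , cong (z ∷_) y≡ , v≡ , proc-e≡p
  restrict-locate p (z ∷ y) u e v eq | no _ with restrict-locate p y u e v eq
  ... | y₁ , y₂ , y≡ , v≡ , proc-e≡p = z ∷ y₁ , y₂ , cong (z ∷_) y≡ , v≡ , proc-e≡p

  quiescent-restrict : ∀ p (y : List (Event P O)) → Quiescent y → Quiescent (restrict p y)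
  quiescent-restrict p y q u p′ o v eq with restrict-locate p y u (inv p′ o) v eq
  ... | y₁ , y₂ , y≡ , v≡ , refl =
    subst (res p′ o ∈_) v≡ (∈-filter⁺ (λ e → proc e ≟ p′) (q y₁ p′ o y₂ y≡) refl)

  even-quiescent : ∀ (x : List (Event P O)) → Legal x →
    (∀ p → even (length (restrict p x)) ≡ true) → Quiescent x
  even-quiescent x legal even-restr u p o v x≡ =
    proj₁ (∈-filter⁻ (λ e → proc e ≟ p) answered)
    where
    open ≡-Reasoning
    split : restrict p x ≡ restrict p u ++ inv p o ∷ restrict p v
    split = begin
      restrict p x                         ≡⟨ cong (restrict p) x≡ ⟩
      restrict p (u ++ inv p o ∷ v)        ≡⟨ filter-++ (λ e → proc e ≟ p) u (inv p o ∷ v) ⟩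
      restrict p u ++ restrict p (inv p o ∷ v)
        ≡⟨ cong (restrict p u ++_) (filter-accept (λ e → proc e ≟ p) refl) ⟩
      restrict p u ++ inv p o ∷ restrict p v ∎
    answered : res p o ∈ restrict p v
    answered = alt-answered (restrict p u) (restrict p v)
      (subst Alt split (legal p)) (subst (λ l → even (length l) ≡ true) split (even-restr p))

  quiescent-↭ : ∀ {x y : List (Event P O)} → Legal x → Legal y → x ↭ y → Quiescent y → Quiescent x
  quiescent-↭ {x} {y} lx ly x↭y qy = even-quiescent x lx λ p →
    ≡-trans (cong even (↭-length (filter-↭ (λ e → proc e ≟ p) x↭y)))
            (alt-quiescent-even (restrict p y) (ly p) (quiescent-restrict p y qy))

  PrefixLegal : List (Event P O) → Set
  PrefixLegal w = ∀ u v → w ≡ u ++ v → Legal u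

  prefixLegal-shift : ∀ (x c r : List (Event P O)) → PrefixLegal (x ++ c ++ r) → PrefixLegal ((x ++ c) ++ r)
  prefixLegal-shift x c r pl u v eq = pl u v (≡-trans (sym (++-assoc x c r)) eq)

  -- The cuts of the block sequence cs (after x): x ++ c₁, x ++ c₁ ++ c₂, ...
  -- are all quiescent.
  data QuiescentCuts (x : List (Event P O)) : List (List (Event P O)) → Set where
    []  : QuiescentCuts x []
    _∷_ : ∀ {c cs} → Quiescent (x ++ c) → QuiescentCuts (x ++ c) cs → QuiescentCuts x (c ∷ cs)

  permuted-cuts : ∀ {x y : List (Event P O)} {bs cs} →
    PrefixLegal (x ++ concat cs) → PrefixLegal (y ++ concat bs) →
    x ↭ y → Quiescent y → All Quiescent bs → Pointwise _↭_ bs cs → QuiescentCuts x cs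
  permuted-cuts _ _ _ _ [] [] = []
  permuted-cuts {x} {y} {b ∷ bs} {c ∷ cs} plx ply x↭y qy (qb ∷ qbs) (b↭c ∷ bs↭cs) =
    qxc ∷ permuted-cuts (prefixLegal-shift x c _ plx) (prefixLegal-shift y b _ ply) xc↭yb qyb qbs bs↭cs
    where
    xc↭yb : x ++ c ↭ y ++ b
    xc↭yb = ↭-++ x↭y (↭-sym b↭c)
    qyb : Quiescent (y ++ b)
    qyb = quiescent-++ qy qb
    qxc : Quiescent (x ++ c)
    qxc = quiescent-↭ (plx (x ++ c) _ (sym (++-assoc x c _)))
                      (ply (y ++ b) _ (sym (++-assoc y b _))) xc↭yb qyb

module _ {A : Set} (M : FA A) where

  path-++ : ∀ {q x r y s} → Path M q x r → Path M r y s → Path M q (x ++ y) s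
  path-++ here        p₂ = p₂
  path-++ (step t p₁) p₂ = step t (path-++ p₁ p₂)

  path-split : ∀ {q} x {y s} → Path M q (x ++ y) s → ∃ λ r → Path M q x r × Path M r y s
  path-split []      p = _ , here , p
  path-split (a ∷ x) (step t p) with path-split x p
  ... | r , p₁ , p₂ = r , step t p₁ , p₂

module WellFormedness {P O : ℕ} {M : FA (Event P O)} (wf : WellFormed M) where

  run-legal : ∀ {w q} → Path M (init M) w q → Legal w
  run-legal p = proj₁ (wf _ _ p)

  final⇒quiescent : ∀ {w q} → Path M (init M) w q → final M q ≡ true → Quiescent w
  final⇒quiescent p = proj₁ (proj₂ (wf _ _ p))

  quiescent⇒final : ∀ {w q} → Path M (init M) w q → Quiescent w → final M q ≡ true
  quiescent⇒final p = proj₂ (proj₂ (wf _ _ p))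

  -- the empty run is quiescent
  init-final : final M (init M) ≡ true
  init-final = quiescent⇒final here quiescent-[]

  run-prefixLegal : ∀ {w q} → Path M (init M) w q → PrefixLegal w
  run-prefixLegal p u v refl = run-legal (proj₁ (proj₂ (path-split M u p)))

module _ {A : Set} where

  erase : List (Ext A) → List A
  erase []         = []
  erase (ev a ∷ w) = a ∷ erase w
  erase (δ ∷ w)    = erase w

  blks : List (List A) → List (Ext A)
  blks []       = []
  blks (b ∷ bs) = map ev b ++ δ ∷ blks bs

  -- δ b₁ δ ⋯ bₖ δ : the shape of the words of L(Qδ) and L(Sδ)
  form : List (List A) → List (Ext A)
  form bs = δ ∷ blks bs

  segments : List (Ext A) → List⁺ (List A)
  segments []         = [] ∷ []
  segments (ev a ∷ w) = let s ∷ ss = segments w in (a ∷ s) ∷ ss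
  segments (δ ∷ w)    = [] ∷ toList (segments w)

  segments-erase : ∀ w → concat (toList (segments w)) ≡ erase w
  segments-erase []         = refl
  segments-erase (ev a ∷ w) = cong (a ∷_) (segments-erase w)
  segments-erase (δ ∷ w)    = segments-erase w

  segments-blk : ∀ b w → segments (map ev b ++ δ ∷ w) ≡ b ∷ toList (segments w)
  segments-blk []      w = refl
  segments-blk (a ∷ b) w rewrite segments-blk b w = refl

  segments-blks : ∀ bs → toList (segments (blks bs)) ≡ bs ++ [] ∷ []
  segments-blks []       = refl
  segments-blks (b ∷ bs) rewrite segments-blk b (blks bs) = cong (b ∷_) (segments-blks bs)

  data Swap : List (Ext A) → List (Ext A) → Set where
    swap-at : ∀ u a b v → Swap (u ++ ev a ∷ ev b ∷ v) (u ++ ev b ∷ ev a ∷ v)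

  Swaps : List (Ext A) → List (Ext A) → Set
  Swaps = Star Swap

  swap-∷ : ∀ {e w w′} → Swap w w′ → Swap (e ∷ w) (e ∷ w′)
  swap-∷ {e} (swap-at u a b v) = swap-at (e ∷ u) a b v

  swap-prefix : ∀ pre {w w′} → Swap w w′ → Swap (pre ++ w) (pre ++ w′)
  swap-prefix []        s = s
  swap-prefix (e ∷ pre) s = swap-∷ (swap-prefix pre s)

  swap-suffix : ∀ suf {w w′} → Swap w w′ → Swap (w ++ suf) (w′ ++ suf)
  swap-suffix suf (swap-at u a b v) = shifted u
    where
    shifted : ∀ u → Swap ((u ++ ev a ∷ ev b ∷ v) ++ suf) ((u ++ ev b ∷ ev a ∷ v) ++ suf)
    shifted []      = swap-at [] a b (v ++ suf)
    shifted (e ∷ u) = swap-∷ (shifted u)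

  closure-along : ∀ {Lang : List (Ext A) → Set} {w w′} → Swaps w w′ →
    SwapClosure Lang w → SwapClosure Lang w′
  closure-along ε                         c = c
  closure-along (swap-at u a b v ◅ steps) c = closure-along steps (swap u a b v c)

  closure-origin : ∀ {Lang : List (Ext A) → Set} {w} → SwapClosure Lang w →
    ∃ λ w′ → Lang w′ × Swaps w w′
  closure-origin (base l) = _ , l , ε
  closure-origin (swap u a b v c) with closure-origin c
  ... | w′ , l , steps = w′ , l , swap-at u b a v ◅ steps

  perm-swaps : ∀ {xs ys : List A} → xs ↭ ys → Swaps (map ev xs) (map ev ys)
  perm-swaps Perm.refl          = ε
  perm-swaps (Perm.prep x p)    = gmap (ev x ∷_) swap-∷ (perm-swaps p)
  perm-swaps (Perm.swap x y p)  =
    swap-at [] x y _ ◅ gmap (λ w → ev y ∷ ev x ∷ w) (λ s → swap-∷ (swap-∷ s)) (perm-swaps p)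
  perm-swaps (Perm.trans p₁ p₂) = perm-swaps p₁ ◅◅ perm-swaps p₂

  blocks-swaps : ∀ {bs cs : List (List A)} → Pointwise _↭_ bs cs → Swaps (blks bs) (blks cs)
  blocks-swaps [] = ε
  blocks-swaps {b ∷ bs} {c ∷ cs} (b↭c ∷ bs↭cs) =
    gmap (_++ δ ∷ blks bs) (swap-suffix (δ ∷ blks bs)) (perm-swaps b↭c) ◅◅
    gmap (λ w → map ev c ++ δ ∷ w) (λ s → swap-prefix (map ev c) (swap-∷ s)) (blocks-swaps bs↭cs)

  swap-segments : ∀ {w w′} → Swap w w′ → Pointwise _↭_ (toList (segments w)) (toList (segments w′))
  swap-segments (swap-at [] a b v) = Perm.swap a b ↭-refl ∷ Pw.refl ↭-refl
  swap-segments (swap-at (ev x ∷ u) a b v) with swap-segments (swap-at u a b v)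
  ... | s↭s′ ∷ ss↭ss′ = Perm.prep x s↭s′ ∷ ss↭ss′
  swap-segments (swap-at (δ ∷ u) a b v) = ↭-refl ∷ swap-segments (swap-at u a b v)

  swaps-segments : ∀ {w w′} → Swaps w w′ → Pointwise _↭_ (toList (segments w)) (toList (segments w′))
  swaps-segments ε           = Pw.refl ↭-refl
  swaps-segments (s ◅ steps) = Pw.transitive ↭-trans (swap-segments s) (swaps-segments steps)

  trailing-empty : ∀ {bs ds : List (List A)} → Pointwise _↭_ (bs ++ [] ∷ []) ds →
    ∃ λ cs → Pointwise _↭_ bs cs × concat ds ≡ concat cs
  trailing-empty {[]}     ([]↭d ∷ []) rewrite ↭-empty-inv (↭-sym []↭d) = [] , [] , refl
  trailing-empty {b ∷ bs} {d ∷ ds} (b↭d ∷ rest) with trailing-empty rest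
  ... | cs , bs↭cs , concat≡ = d ∷ cs , b↭d ∷ bs↭cs , cong (d ++_) concat≡

⌊≟⌋-refl : ∀ {m} (q : Fin m) → ⌊ q ≟ q ⌋ ≡ true
⌊≟⌋-refl q = ≡-trans (isYes≗does (q ≟ q)) (dec-true (q ≟ q) refl)

module _ {A : Set} (S : FA A) where

  Sδ-loop : ∀ {q} → final S q ≡ true → trans (Sδ S) q δ q ≡ true
  Sδ-loop {q} fq rewrite fq = ⌊≟⌋-refl q

  -- (in every other case the transition is  false ≡ true , so absurd)
  Sδ-loop-inv : ∀ {q q′} → trans (Sδ S) q δ q′ ≡ true → q ≡ q′
  Sδ-loop-inv {q} {q′} t with final S q | q ≟ q′
  ... | true | yes q≡q′ = q≡q′

  Sδ-erase : ∀ {q w r} → Path (Sδ S) q w r → Path S q (erase w) r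
  Sδ-erase here = here
  Sδ-erase {w = ev a ∷ w} (step t p) = step t (Sδ-erase p)
  Sδ-erase {w = δ ∷ w}    (step t p) with refl ← Sδ-loop-inv t = Sδ-erase p

  Sδ-lift : ∀ {q w r} → Path S q w r → Path (Sδ S) q (map ev w) r
  Sδ-lift here       = here
  Sδ-lift (step t p) = step t (Sδ-lift p)

  LU-form : ∀ {bs cs} → Pointwise _↭_ bs cs → L (Sδ S) (form cs) → LU (Sδ S) (form bs)
  LU-form bs↭cs acc =
    closure-along (gmap (δ ∷_) swap-∷ (blocks-swaps (Pw.symmetric ↭-sym bs↭cs))) (base acc)

  LU-form-inv : ∀ bs → LU (Sδ S) (form bs) → ∃ λ cs → Pointwise _↭_ bs cs × L S (concat cs)
  LU-form-inv bs lu with closure-origin lu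
  ... | w′ , (q , p , fq) , steps with swaps-segments steps
  ... | []↭d₀ ∷ segs
    with trailing-empty (subst (λ ss → Pointwise _↭_ ss (List⁺.tail (segments w′))) (segments-blks bs) segs)
  ... | cs , bs↭cs , concat≡ =
    cs , bs↭cs , q , subst (λ w → Path S (init S) w q) erase≡ (Sδ-erase p) , fq
    where
    open ≡-Reasoning
    erase≡ : erase w′ ≡ concat cs
    erase≡ = begin
      erase w′                                          ≡⟨ sym (segments-erase w′) ⟩
      List⁺.head (segments w′) ++ concat (List⁺.tail (segments w′))
        ≡⟨ cong (_++ concat (List⁺.tail (segments w′))) (↭-empty-inv (↭-sym []↭d₀)) ⟩
      concat (List⁺.tail (segments w′))                 ≡⟨ concat≡ ⟩
      concat cs                                         ∎

module _ {P O : ℕ} {S : FA (Event P O)} (wf : WellFormed S) where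
  open WellFormedness wf

  δ-insert : ∀ {x r cs s} → Path S (init S) x r → Path S r (concat cs) s →
    QuiescentCuts x cs → Path (Sδ S) r (blks cs) s
  δ-insert _  here [] = here
  δ-insert {x} {cs = c ∷ cs} px pcs (qxc ∷ qcs) with path-split S c pcs
  ... | r′ , pc , prest =
    path-++ (Sδ S) (Sδ-lift S pc) (step (Sδ-loop S (quiescent⇒final pxc qxc)) (δ-insert pxc prest qcs))
    where
    pxc : Path S (init S) (x ++ c) r′
    pxc = path-++ S px pc

  Sδ-accepts : ∀ {cs} → L S (concat cs) → QuiescentCuts [] cs → L (Sδ S) (form cs)
  Sδ-accepts (s , p , fs) cuts = s , step (Sδ-loop S init-final) (δ-insert here p cuts) , fs

-- Blocks of a path of Q: the stretches between consecutive visits to final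
-- states.  Qδ reads precisely such block sequences, with a δ after each block.
module QBlocks {A : Set} (Q : FA A) where

  State : Set
  State = Fin (n Q)

  data Tail : State → List A → State → Set where
    stop : ∀ {q} → final Q q ≡ true → Tail q [] q
    go   : ∀ {q a q′ t s} → final Q q ≡ false → trans Q q a q′ ≡ true → Tail q′ t s → Tail q (a ∷ t) s

  data Block : State → List A → State → Set where
    block : ∀ {r a q t s} → trans Q r a q ≡ true → Tail q t s → Block r (a ∷ t) s

  data Blocks : State → List (List A) → State → Set where
    []  : ∀ {r} → Blocks r [] r
    _∷_ : ∀ {r b s bs s′} → Block r b s → Blocks s bs s′ → Blocks r (b ∷ bs) s′

  tail-path : ∀ {q t s} → Tail q t s → Path Q q t s
  tail-path (stop _)    = here
  tail-path (go _ t tl) = step t (tail-path tl)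

  tail-final : ∀ {q t s} → Tail q t s → final Q s ≡ true
  tail-final (stop fq)   = fq
  tail-final (go _ _ tl) = tail-final tl

  block-path : ∀ {r b s} → Block r b s → Path Q r b s
  block-path (block t tl) = step t (tail-path tl)

  block-final : ∀ {r b s} → Block r b s → final Q s ≡ true
  block-final (block _ tl) = tail-final tl

  block-nonempty : ∀ {r b s} → Block r b s → b ≢ []
  block-nonempty (block _ _) ()

  tail-interior : ∀ u {q v s} → Tail q (u ++ v) s → v ≢ [] → ∃ λ q′ → Path Q q u q′ × final Q q′ ≡ false
  tail-interior []      (stop _)     v≢[] = ⊥-elim (v≢[] refl)
  tail-interior []      (go fq _ _)  _    = _ , here , fq
  tail-interior (a ∷ u) (go _ t tl) v≢[] with tail-interior u tl v≢[]
  ... | q′ , p , fq′ = q′ , step t p , fq′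

  block-interior : ∀ u {r v s} → Block r (u ++ v) s → u ≢ [] → v ≢ [] →
    ∃ λ q → Path Q r u q × final Q q ≡ false
  block-interior []      _             u≢[] _    = ⊥-elim (u≢[] refl)
  block-interior (a ∷ u) (block t tl) _    v≢[] with tail-interior u tl v≢[]
  ... | q , p , fq = q , step t p , fq

  mutual
    path-tail : ∀ {q w s} → Path Q q w s → final Q s ≡ true →
      ∃ λ t → ∃ λ bs → ∃ λ s′ → Tail q t s′ × Blocks s′ bs s × w ≡ t ++ concat bs
    path-tail {q} p fs with final Q q in fq
    ... | true with path-blocks p fs
    ...   | bs , bls , w≡ = [] , bs , q , stop fq , bls , sym w≡
    path-tail here       fs | false with () ← ≡-trans (sym fs) fq
    path-tail (step {a = a} t p) fs | false with path-tail p fs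
    ... | tl , bs , s′ , tail , bls , w≡ = a ∷ tl , bs , s′ , go fq t tail , bls , cong (a ∷_) w≡

    path-blocks : ∀ {r w s} → Path Q r w s → final Q s ≡ true →
      ∃ λ bs → Blocks r bs s × concat bs ≡ w
    path-blocks here       _  = [] , [] , refl
    path-blocks (step {a = a} t p) fs with path-tail p fs
    ... | tl , bs , _ , tail , bls , w≡ = (a ∷ tl) ∷ bs , block t tail ∷ bls , cong (a ∷_) (sym w≡)

  blocks-path : ∀ {r bs s} → Blocks r bs s → Path Q r (concat bs) s
  blocks-path []         = here
  blocks-path (bl ∷ bls) = path-++ Q (block-path bl) (blocks-path bls)

  data Move : State ⊎ State → Ext A → State ⊎ State → Set where
    quiesce : ∀ {q} → final Q q ≡ true → Move (inj₁ q) δ (inj₂ q)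
    active  : ∀ {q a q′} → final Q q ≡ false → trans Q q a q′ ≡ true → Move (inj₁ q) (ev a) (inj₁ q′)
    resume  : ∀ {q a q′} → trans Q q a q′ ≡ true → Move (inj₂ q) (ev a) (inj₁ q′)

  data Moves : State ⊎ State → List (Ext A) → State ⊎ State → Set where
    []  : ∀ {s} → Moves s [] s
    _∷_ : ∀ {s e t w u} → Move s e t → Moves t w u → Moves s (e ∷ w) u

  Accepting : State ⊎ State → Set
  Accepting (inj₁ _) = ⊥
  Accepting (inj₂ q) = final Q q ≡ true

  ⟦_⟧ : State ⊎ State → Fin (n (Qδ Q))
  ⟦ s ⟧ = join (n Q) (n Q) s

  move-sound : ∀ {s e t} → Move s e t → trans (Qδ Q) ⟦ s ⟧ e ⟦ t ⟧ ≡ true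
  move-sound {inj₁ q} (quiesce fq)
    rewrite splitAt-join (n Q) (n Q) (inj₁ q) | splitAt-join (n Q) (n Q) (inj₂ q) | fq = ⌊≟⌋-refl q
  move-sound {inj₁ q} {t = inj₁ q′} (active fq t)
    rewrite splitAt-join (n Q) (n Q) (inj₁ q) | splitAt-join (n Q) (n Q) (inj₁ q′) | fq = t
  move-sound {inj₂ q} {t = inj₁ q′} (resume t)
    rewrite splitAt-join (n Q) (n Q) (inj₂ q) | splitAt-join (n Q) (n Q) (inj₁ q′) = t

  -- (the remaining combinations of states have no transition: the hypothesis
  -- reduces to  false ≡ true)
  move-complete : ∀ i e j → trans (Qδ Q) i e j ≡ true → Move (splitAt (n Q) i) e (splitAt (n Q) j)
  move-complete i e j t with splitAt (n Q) i | splitAt (n Q) j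
  move-complete i δ      j t | inj₁ q | inj₂ q′ with final Q q in fq | q ≟ q′
  ... | true | yes refl = quiesce fq
  move-complete i (ev a) j t | inj₁ q | inj₁ q′ with final Q q in fq
  ... | false = active fq t
  move-complete i (ev a) j t | inj₂ q | inj₁ q′ = resume t

  accepting-sound : ∀ {q} → final Q q ≡ true → final (Qδ Q) ⟦ inj₂ q ⟧ ≡ true
  accepting-sound {q} fq rewrite splitAt-join (n Q) (n Q) (inj₂ q) = fq

  accepting-complete : ∀ i → final (Qδ Q) i ≡ true → Accepting (splitAt (n Q) i)
  accepting-complete i fi with splitAt (n Q) i
  ... | inj₂ q = fi

  accepted-moves : ∀ {i w j s} → splitAt (n Q) i ≡ s → Path (Qδ Q) i w j → final (Qδ Q) j ≡ true →
    ∃ λ u → Moves s w u × Accepting u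
  accepted-moves i≡ here fj = _ , [] , subst Accepting i≡ (accepting-complete _ fj)
  accepted-moves i≡ (step tr p) fj with accepted-moves refl p fj
  ... | u , ms , acc = u , subst (λ s → Move s _ _) i≡ (move-complete _ _ _ tr) ∷ ms , acc

  tail-δ : ∀ {q t s w j} → Tail q t s → Path (Qδ Q) ⟦ inj₂ s ⟧ w j →
    Path (Qδ Q) ⟦ inj₁ q ⟧ (map ev t ++ δ ∷ w) j
  tail-δ (stop fq)    p = step (move-sound (quiesce fq)) p
  tail-δ (go fq t tl) p = step (move-sound (active fq t)) (tail-δ tl p)

  blocks-δ : ∀ {r bs s} → Blocks r bs s → Path (Qδ Q) ⟦ inj₂ r ⟧ (blks bs) ⟦ inj₂ s ⟧
  blocks-δ []                 = here
  blocks-δ (block t tl ∷ bls) = step (move-sound (resume t)) (tail-δ tl (blocks-δ bls))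

  Qδ-accepts : ∀ {bs s} → final Q (init Q) ≡ true → Blocks (init Q) bs s → final Q s ≡ true →
    L (Qδ Q) (form bs)
  Qδ-accepts fi bls fs = ⟦ inj₂ _ ⟧ , step (move-sound (quiesce fi)) (blocks-δ bls) , accepting-sound fs

  mutual
    moves-tail : ∀ {q w u} → Moves (inj₁ q) w u → Accepting u →
      ∃ λ t → ∃ λ s → ∃ λ bs → ∃ λ s′ →
        Tail q t s × Blocks s bs s′ × final Q s′ ≡ true × w ≡ map ev t ++ δ ∷ blks bs
    moves-tail [] ()
    moves-tail (quiesce fq ∷ ms) acc with moves-blocks ms acc
    ... | bs , s′ , bls , fs′ , w≡ = [] , _ , bs , s′ , stop fq , bls , fs′ , cong (δ ∷_) w≡
    moves-tail (active {a = a} fq t ∷ ms) acc with moves-tail ms acc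
    ... | tl , s , bs , s′ , tail , bls , fs′ , w≡ =
      a ∷ tl , s , bs , s′ , go fq t tail , bls , fs′ , cong (ev a ∷_) w≡

    moves-blocks : ∀ {r w u} → Moves (inj₂ r) w u → Accepting u →
      ∃ λ bs → ∃ λ s → Blocks r bs s × final Q s ≡ true × w ≡ blks bs
    moves-blocks [] fr = [] , _ , [] , fr , refl
    moves-blocks (resume {a = a} t ∷ ms) acc with moves-tail ms acc
    ... | tl , _ , bs , s′ , tail , bls , fs′ , w≡ =
      (a ∷ tl) ∷ bs , s′ , block t tail ∷ bls , fs′ , cong (ev a ∷_) w≡

  Qδ-accepted : ∀ {w} → final Q (init Q) ≡ true → L (Qδ Q) w →
    ∃ λ bs → ∃ λ s → Blocks (init Q) bs s × final Q s ≡ true × w ≡ form bs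
  Qδ-accepted fi (_ , p , fj) with accepted-moves (splitAt-join (n Q) (n Q) (inj₁ (init Q))) p fj
  ... | _ , [] , ()
  ... | _ , quiesce _ ∷ ms , acc with moves-blocks ms acc
  ...   | bs , s , bls , fs , w≡ = bs , s , bls , fs , cong (δ ∷_) w≡
  Qδ-accepted fi (_ , p , fj) | _ , active fi′ _ ∷ _ , _ with () ← ≡-trans (sym fi) fi′

module _ {P O : ℕ} {Q : FA (Event P O)} (wf : WellFormed Q) where
  open WellFormedness wf
  open QBlocks Q

  -- a block after a quiescent run: it ends quiescent, and a quiescent proper
  -- prefix would extend the run to a final state inside the block
  block-endToEnd : ∀ {x r b s} → Path Q (init Q) x r → Quiescent x → Block r b s → EndToEnd b
  block-endToEnd {x} {r} {b} {s} px qx bl =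
    block-nonempty bl , quiescent-suffix x b (final⇒quiescent pxb (block-final bl)) , no-quiescent-prefix
    where
    pxb : Path Q (init Q) (x ++ b) s
    pxb = path-++ Q px (block-path bl)
    no-quiescent-prefix : ∀ u v → b ≡ u ++ v → u ≢ [] → v ≢ [] → ¬ Quiescent u
    no-quiescent-prefix u v b≡ u≢[] v≢[] qu
      with block-interior u (subst (λ b → Block r b s) b≡ bl) u≢[] v≢[]
    ... | q , pu , fq with () ← ≡-trans (sym (quiescent⇒final (path-++ Q px pu) (quiescent-++ qx qu))) fq

  blocks-endToEnd : ∀ {x r bs s} → Path Q (init Q) x r → Quiescent x → Blocks r bs s → All EndToEnd bs
  blocks-endToEnd px qx []         = []
  blocks-endToEnd {x} px qx (_∷_ {b = b} {s} bl bls) =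
    block-endToEnd px qx bl ∷ blocks-endToEnd pxb (final⇒quiescent pxb (block-final bl)) bls
    where
    pxb : Path Q (init Q) (x ++ b) s
    pxb = path-++ Q px (block-path bl)

  Qδ-from-run : ∀ {w} → L Q w → ∃ λ bs → All EndToEnd bs × concat bs ≡ w × L (Qδ Q) (form bs)
  Qδ-from-run (s , p , fs) with path-blocks p fs
  ... | bs , bls , concat≡ =
    bs , blocks-endToEnd here quiescent-[] bls , concat≡ , Qδ-accepts init-final bls fs

  run-from-Qδ : ∀ {w} → L (Qδ Q) w → ∃ λ bs → All EndToEnd bs × L Q (concat bs) × w ≡ form bs
  run-from-Qδ acc with Qδ-accepted init-final acc
  ... | bs , s , bls , fs , w≡ =
    bs , blocks-endToEnd here quiescent-[] bls , (s , blocks-path bls , fs) , w≡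

permuted-run-Sδ : ∀ {P O} {S Q : FA (Event P O)} → WellFormed S → WellFormed Q →
  ∀ {bs cs} → L Q (concat bs) → All EndToEnd bs → Pointwise _↭_ bs cs → L S (concat cs) →
  L (Sδ S) (form cs)
permuted-run-Sδ {S = S} wfS wfQ (_ , pQ , _) e2e bs↭cs runS@(_ , pS , _) =
  Sδ-accepts {S = S} wfS runS
    (permuted-cuts (WellFormedness.run-prefixLegal wfS pS) (WellFormedness.run-prefixLegal wfQ pQ)
                   ↭-refl quiescent-[] (All.map (λ e2e-b → proj₁ (proj₂ e2e-b)) e2e) bs↭cs)

-- The theorem.  (⇒) A word of L(Qδ) is  form bs  for the end-to-end blocks bs
-- of a run of Q; correctness permutes them block-wise into cs with concat cs
-- a run of S, whose cuts are quiescent, so  form cs ∈ L(Sδ)  and  form bs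
-- is obtained from it by swaps.  (⇐) Conversely  form bs ∈ L(Qδ)  for the
-- end-to-end blocks of any run of Q, and its swap-equivalent words in L(Sδ)
-- provide the block-wise permutation required by correctness.
mainTheorem6 : {P O : ℕ} (S Q : FA (Event P O)) →
    WellFormed S → WellFormed Q →
    CorrectQC S Q ⇔ (∀ (w : List (Ext (Event P O))) → L (Qδ Q) w → LU (Sδ S) w)
mainTheorem6 S Q wfS wfQ = mk⇔ correct⇒inclusion inclusion⇒correct
  where
  allowed-LU : ∀ {bs} → All EndToEnd bs → L Q (concat bs) → Allowed S (concat bs) → LU (Sδ S) (form bs)
  allowed-LU {bs} e2e runQ (bs′ , e2e′ , concat≡ , cs , bs′↭cs , runS) =
    LU-form S bs↭cs (permuted-run-Sδ wfS wfQ runQ e2e bs↭cs runS)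
    where
    -- the end-to-end decomposition is unique, so bs′ is bs
    bs↭cs : Pointwise _↭_ bs cs
    bs↭cs = subst (λ bs″ → Pointwise _↭_ bs″ cs) (endToEnd-unique bs′ bs e2e′ e2e concat≡) bs′↭cs

  correct⇒inclusion : CorrectQC S Q → ∀ w → L (Qδ Q) w → LU (Sδ S) w
  correct⇒inclusion correct w acc with run-from-Qδ wfQ acc
  ... | bs , e2e , runQ , refl = allowed-LU e2e runQ (correct (concat bs) runQ)

  inclusion⇒correct : (∀ w → L (Qδ Q) w → LU (Sδ S) w) → CorrectQC S Q
  inclusion⇒correct incl w acc with Qδ-from-run wfQ acc
  ... | bs , e2e , concat≡ , accδ with LU-form-inv S bs (incl (form bs) accδ)
  ... | cs , bs↭cs , runS = bs , e2e , concat≡ , cs , bs↭cs , runS
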